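{- Let $1\leq p\leq k$ and let $O$ be an optimal solution of the OptPDVC instance (a viable set with $|O|\leq k$ of maximum value). Then there exist $\lceil k/p\rceil$ pairs $(O_1,B_1),\dots,(O_{\lceil k/p\rceil},B_{\lceil k/p\rceil})$ of subsets of $X$ such that $O=\bigcup_{i=1}^{\lceil k/p\rceil} O_i$, each $O_i\cup B_i$ is viable, $|O_i|\leq p$, $|B_i|\leq d-1$, and $\sum_{i}|O_i\cup B_i|\leq \frac{k}{p}(p+d-1)$.
   Context: Let $X$ be a finite set, $f:2^X\to\mathbb{R}_{\geq 0}$ a non-negative monotone submodular function, and $D=(X,E)$ a directed acyclic graph (food web). A set $S\subseteq X$ is viable if every $s\in S$ is a sink of $D$ or has an out-neighbour in $S$. For a positive integer $k$, OptPDVC asks for a viable $S$ with $|S|\leq k$ maximizing $f(S)$. The truncated depth is $d=\min(L,k)$, where $L$ is the maximum number of nodes on a directed path of $D$ ending at a sink.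
   Formalization: The monotone submodular function f takes nonnegative rational values rather than values in $\mathbb{R}_{\geq 0}$. -}

module Defs where

open import Data.Nat using (ℕ; zero; suc; _+_; _∸_; _/_; _≤_; _⊓_)
open import Data.Fin using (Fin)
open import Data.Fin.Subset using (Subset; _∈_; _⊆_; _∪_; _∩_; ∣_∣)
open import Data.Bool using (Bool; T)
open import Data.List using (List; []; _∷_; length)
open import Data.Product using (_×_; ∃)
open import Data.Sum using (_⊎_)
open import Data.Empty using (⊥)
open import Relation.Nullary using (¬_)
open import Relation.Binary.PropositionalEquality using (_≡_)
open import Relation.Binary.Construct.Closure.Transitive using (TransClosure)
import Data.Rational as ℚ
open ℚ using (ℚ)

Digraph : ℕ → Set
Digraph n = Fin n → Fin n → Bool

module _ {n : ℕ} (D : Digraph n) where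

  Edge : Fin n → Fin n → Set
  Edge u v = T (D u v)

  Acyclic : Set
  Acyclic = ∀ v → ¬ TransClosure Edge v v

  Sink : Fin n → Set
  Sink u = ∀ v → ¬ Edge u v

  Viable : Subset n → Set
  Viable S = ∀ s → s ∈ S → Sink s ⊎ ∃ λ v → Edge s v × v ∈ S

  SinkPath : List (Fin n) → Set
  SinkPath []           = ⊥
  SinkPath (v ∷ [])     = Sink v
  SinkPath (u ∷ v ∷ vs) = Edge u v × SinkPath (v ∷ vs)

  -- L is the maximum number of nodes on a directed path ending at a sink
  -- (L = 0 when there is no such path, i.e. X is empty)
  IsMaxSinkPathNodes : ℕ → Set
  IsMaxSinkPathNodes L =
    (∀ ps → SinkPath ps → length ps ≤ L) ×
    ((∃ λ ps → SinkPath ps × length ps ≡ L) ⊎ L ≡ 0)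

-- ⌈ k / p ⌉ for p ≥ 1 (value 0 for p = 0, never used)
⌈_/_⌉ : ℕ → ℕ → ℕ
⌈ k / zero ⌉  = 0
⌈ k / suc q ⌉ = (k + q) / suc q

module _ {n : ℕ} (f : Subset n → ℚ) where

  NonNegative : Set
  NonNegative = ∀ S → ℚ.0ℚ ℚ.≤ f S

  Monotone : Set
  Monotone = ∀ S T → S ⊆ T → f S ℚ.≤ f T

  Submodular : Set
  Submodular = ∀ S T → (f (S ∪ T) ℚ.+ f (S ∩ T)) ℚ.≤ (f S ℚ.+ f T)

module _ {n : ℕ} (D : Digraph n) (f : Subset n → ℚ) (k : ℕ) where

  Feasible : Subset n → Set
  Feasible S = Viable D S × ∣ S ∣ ≤ k

  Optimal : Subset n → Set
  Optimal O = Feasible O × (∀ S → Feasible S → f S ℚ.≤ f O)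

-- Choose for every non-sink v ∈ O an out-neighbour next v ∈ O. This makes O a forest whose roots
-- are the sinks of O, and following next from any vertex of O reaches a root along a sink-path.
-- List O in depth-first preorder: each vertex is a root, or its parent lies on the path from the
-- preceding vertex to its root. Cut the listing into ⌈k/p⌉ consecutive chunks O_i of at most p
-- vertices, and let B_i be the path from the first vertex of O_i to its root, without that vertex.
-- Then O_i ∪ B_i is closed under next, hence viable. B_i lies on a sink-path and in O minus one
-- vertex, so |B_i| ≤ min(L, k) − 1, and B_1 = ∅ since the listing starts with a root. Summing,
-- Σ |O_i ∪ B_i| ≤ |O| + (⌈k/p⌉ − 1)(min(L, k) − 1), and p (⌈k/p⌉ − 1) ≤ k gives the bound.
module Submission where

open import Algebra.Properties.CommutativeSemigroup using (interchange)
open import Data.Bool.Properties using (T?)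
open import Data.Empty using (⊥-elim)
open import Data.Fin using (Fin; zero; suc; toℕ; fromℕ<; _≟_)
open import Data.Fin.Properties using (all?; any?; pigeonhole; toℕ<n; toℕ-fromℕ<)
open import Data.Fin.Subset
  using (Subset; _∈_; _∉_; _⊆_; _⊂_; _∪_; ⋃; ∣_∣; ⁅_⁆; inside; outside) renaming (⊥ to ∅)
open import Data.Fin.Subset.Properties
  using (_∈?_; x∈p∪q⁺; x∈p∪q⁻; x∈⁅x⁆; x∈⁅y⁆⇒x≡y; ∉⊥; ∣⊥∣≡0; ∣⁅x⁆∣≡1; ⊆-antisym; p⊂q⇒∣p∣<∣q∣)
open import Data.List using (List; []; _∷_; _++_; length; map; allFin; take; drop)
open import Data.List.Membership.Propositional using () renaming (_∈_ to _∈ₗ_)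
open import Data.List.Membership.Propositional.Properties using (∈-++⁺ˡ; ∈-++⁺ʳ; ∈-++⁻; ∈-allFin)
open import Data.List.Properties using (map-tabulate; length-take; length-drop; length-++; take++drop≡id)
open import Data.List.Relation.Binary.Permutation.Propositional as ↭ using (_↭_; ↭-sym; ↭⇒↭ₛ)
open import Data.List.Relation.Binary.Permutation.Propositional.Properties using (All-resp-↭; ∈-resp-↭)
import Data.List.Relation.Binary.Permutation.Setoid.Properties as PermutationSetoid
open import Data.List.Relation.Unary.All as All using (All; []; _∷_)
open import Data.List.Relation.Unary.All.Properties using (¬Any⇒All¬; take⁺; drop⁺)
open import Data.List.Relation.Unary.Any using (here; there)
open import Data.List.Relation.Unary.Unique.Propositional using (Unique; []; _∷_)
open import Data.Maybe using (Maybe; just; nothing)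
open import Data.Nat using (ℕ; zero; suc; _+_; _*_; _∸_; _≤_; _<_; _⊓_; _%_; z≤n; s≤s)
open import Data.Nat.DivMod using (m≡m%n+[m/n]*n; m%n<n; m/n*n≤m)
open import Data.Nat.GeneralisedArithmetic using (iterate)
open import Data.Nat.ListAction using (sum)
open import Data.Nat.Properties
  using ( ≤-refl; ≤-reflexive; ≤-trans; <⇒≤; ≤-pred; n≤1+n; m≤n⇒∃[o]m+o≡n; module ≤-Reasoning
        ; +-comm; +-suc; +-mono-≤; +-monoˡ-≤; +-monoʳ-≤; +-cancelʳ-≤; +-commutativeSemigroup
        ; *-comm; *-assoc; *-identityˡ; *-zeroʳ; *-distribˡ-+; *-distribʳ-∸; *-monoˡ-≤; *-monoʳ-≤
        ; ∸-monoˡ-≤; ∸-monoʳ-≤; m+n∸m≡n; m+n∸n≡m; ⊓-glb; m⊓n≤m; ∸-distribʳ-⊓ )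
open import Data.Product using (Σ; _×_; _,_; proj₁; proj₂; ∃-syntax)
open import Data.Rational using (ℚ)
open import Data.Sum as Sum using (_⊎_; inj₁; inj₂)
open import Data.Unit using (⊤; tt)
import Data.Vec as Vec
import Data.Vec.Functional as Vector
open import Function using (_∘_)
open import Relation.Binary.Construct.Closure.Transitive using (TransClosure; [_]; _∷_)
open import Relation.Binary.PropositionalEquality
open import Relation.Nullary using (¬_; Dec; yes; no; ¬?; contradiction)
open import Relation.Nullary.Decidable using (_⊎-dec_; _×-dec_)

open import Defs

module _ {n : ℕ} where

  fromList : List (Fin n) → Subset n
  fromList []       = ∅
  fromList (x ∷ xs) = ⁅ x ⁆ ∪ fromList xs

  ∈-fromList⁺ : ∀ {x xs} → x ∈ₗ xs → x ∈ fromList xs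
  ∈-fromList⁺ (here refl)  = x∈p∪q⁺ (inj₁ (x∈⁅x⁆ _))
  ∈-fromList⁺ (there x∈xs) = x∈p∪q⁺ (inj₂ (∈-fromList⁺ x∈xs))

  ∈-fromList⁻ : ∀ {x} xs → x ∈ fromList xs → x ∈ₗ xs
  ∈-fromList⁻ []       x∈ = ⊥-elim (∉⊥ x∈)
  ∈-fromList⁻ (y ∷ ys) x∈ with x∈p∪q⁻ ⁅ y ⁆ (fromList ys) x∈
  ... | inj₁ x∈⁅y⁆ = here (x∈⁅y⁆⇒x≡y y x∈⁅y⁆)
  ... | inj₂ x∈ys  = there (∈-fromList⁻ ys x∈ys)

  fromList-++ : ∀ xs ys → fromList (xs ++ ys) ≡ fromList xs ∪ fromList ys
  fromList-++ xs ys = ⊆-antisym ⊆∪ ∪⊆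
    where
    ⊆∪ : fromList (xs ++ ys) ⊆ fromList xs ∪ fromList ys
    ⊆∪ x∈ = x∈p∪q⁺ (Sum.map ∈-fromList⁺ ∈-fromList⁺ (∈-++⁻ xs (∈-fromList⁻ (xs ++ ys) x∈)))
    ∪⊆ : fromList xs ∪ fromList ys ⊆ fromList (xs ++ ys)
    ∪⊆ x∈ with x∈p∪q⁻ (fromList xs) (fromList ys) x∈
    ... | inj₁ x∈xs = ∈-fromList⁺ (∈-++⁺ˡ (∈-fromList⁻ xs x∈xs))
    ... | inj₂ x∈ys = ∈-fromList⁺ (∈-++⁺ʳ xs (∈-fromList⁻ ys x∈ys))

  insertAfter : Fin n → Fin n → List (Fin n) → List (Fin n)
  insertAfter a y []       = []
  insertAfter a y (x ∷ xs) with x ≟ a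
  ... | yes _ = x ∷ y ∷ xs
  ... | no  _ = x ∷ insertAfter a y xs

  insertAfter-↭ : ∀ {a y xs} → a ∈ₗ xs → insertAfter a y xs ↭ y ∷ xs
  insertAfter-↭ {a} {y} {x ∷ xs} a∈ with x ≟ a | a∈
  ... | yes _   | _          = ↭.swap x y ↭.refl
  ... | no  x≢a | here a≡x   = contradiction (sym a≡x) x≢a
  ... | no  _   | there a∈xs = ↭.trans (↭.prep x (insertAfter-↭ a∈xs)) (↭.swap x y ↭.refl)

∣p∪q∣≤∣p∣+∣q∣ : ∀ {n} (p q : Subset n) → ∣ p ∪ q ∣ ≤ ∣ p ∣ + ∣ q ∣
∣p∪q∣≤∣p∣+∣q∣ Vec.[]            Vec.[]            = z≤n
∣p∪q∣≤∣p∣+∣q∣ (inside  Vec.∷ p) (inside  Vec.∷ q) =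
  s≤s (≤-trans (∣p∪q∣≤∣p∣+∣q∣ p q) (+-monoʳ-≤ ∣ p ∣ (n≤1+n ∣ q ∣)))
∣p∪q∣≤∣p∣+∣q∣ (inside  Vec.∷ p) (outside Vec.∷ q) = s≤s (∣p∪q∣≤∣p∣+∣q∣ p q)
∣p∪q∣≤∣p∣+∣q∣ (outside Vec.∷ p) (inside  Vec.∷ q) =
  subst (suc ∣ p ∪ q ∣ ≤_) (sym (+-suc ∣ p ∣ ∣ q ∣)) (s≤s (∣p∪q∣≤∣p∣+∣q∣ p q))
∣p∪q∣≤∣p∣+∣q∣ (outside Vec.∷ p) (outside Vec.∷ q) = ∣p∪q∣≤∣p∣+∣q∣ p q

∣fromList∣≤length : ∀ {n} (xs : List (Fin n)) → ∣ fromList xs ∣ ≤ length xs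
∣fromList∣≤length {n} []       = ≤-reflexive (∣⊥∣≡0 n)
∣fromList∣≤length     (x ∷ xs) = begin
  ∣ ⁅ x ⁆ ∪ fromList xs ∣       ≤⟨ ∣p∪q∣≤∣p∣+∣q∣ ⁅ x ⁆ (fromList xs) ⟩
  ∣ ⁅ x ⁆ ∣ + ∣ fromList xs ∣   ≤⟨ +-mono-≤ (≤-reflexive (∣⁅x⁆∣≡1 x)) (∣fromList∣≤length xs) ⟩
  1 + length xs                 ∎
  where open ≤-Reasoning

Unique⇒length≤∣p∣ : ∀ {n} {p : Subset n} {xs} → Unique xs → All (_∈ p) xs → length xs ≤ ∣ p ∣
Unique⇒length≤∣p∣ [] [] = z≤n
Unique⇒length≤∣p∣ {p = p} {x ∷ xs} (x≢xs ∷ unique) (x∈p ∷ xs⊆p) = begin-strict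
  length xs        ≤⟨ Unique⇒length≤∣p∣ unique (All.tabulate ∈-fromList⁺) ⟩
  ∣ fromList xs ∣  <⟨ p⊂q⇒∣p∣<∣q∣ (All.lookup xs⊆p ∘ ∈-fromList⁻ xs , x , x∈p , x∉xs) ⟩
  ∣ p ∣            ∎
  where
  open ≤-Reasoning
  x∉xs : x ∉ fromList xs
  x∉xs x∈ = All.lookup x≢xs (∈-fromList⁻ xs x∈) refl

length-drop≤ : ∀ {a} {A : Set a} p m (xs : List A) → length xs ≤ suc m * p → length (drop p xs) ≤ m * p
length-drop≤ p m xs len = begin
  length (drop p xs)  ≡⟨ length-drop p xs ⟩
  length xs ∸ p       ≤⟨ ∸-monoˡ-≤ p len ⟩
  p + m * p ∸ p       ≡⟨ m+n∸m≡n p (m * p) ⟩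
  m * p               ∎
  where open ≤-Reasoning

map-allFin-suc : ∀ {a} {A : Set a} {m} (f : Fin (suc m) → A) →
                 map f (allFin (suc m)) ≡ f zero ∷ map (f ∘ suc) (allFin m)
map-allFin-suc f =
  cong (f zero ∷_) (trans (map-tabulate suc f) (sym (map-tabulate (λ i → i) (f ∘ suc))))

iterate-+ : ∀ {a} {A : Set a} (f : A → A) x m t → iterate f x (m + t) ≡ iterate f (iterate f x m) t
iterate-+ f x zero    t = refl
iterate-+ f x (suc m) t = iterate-+ f (f x) m t

-- Decompositions into viable pieces

module _ {n : ℕ} (D : Digraph n) (p b : ℕ) where

  record Decomposition (m : ℕ) (S : Subset n) (cost : ℕ) : Set where
    field
      Os Bs    : Fin m → Subset n
      covers   : S ≡ ⋃ (map Os (allFin m))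
      viable   : ∀ i → Viable D (Os i ∪ Bs i)
      Os-small : ∀ i → ∣ Os i ∣ ≤ p
      Bs-small : ∀ i → ∣ Bs i ∣ ≤ b
      total    : sum (map (λ i → ∣ Os i ∪ Bs i ∣) (allFin m)) ≤ cost

  open Decomposition

  decomposition-∅ : Decomposition 0 ∅ 0
  decomposition-∅ = record
    { Os = λ () ; Bs = λ () ; covers = refl ; viable = λ ()
    ; Os-small = λ () ; Bs-small = λ () ; total = z≤n }

  decomposition-∷ : ∀ {m S cost} (O₀ B₀ : Subset n) →
                    Viable D (O₀ ∪ B₀) → ∣ O₀ ∣ ≤ p → ∣ B₀ ∣ ≤ b → Decomposition m S cost →
                    Decomposition (suc m) (O₀ ∪ S) (∣ O₀ ∪ B₀ ∣ + cost)
  decomposition-∷ {m} {cost = cost} O₀ B₀ viable₀ O₀-small B₀-small Δ = record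
    { Os       = Os′
    ; Bs       = Bs′
    ; covers   = trans (cong (O₀ ∪_) (covers Δ)) (cong ⋃ (sym (map-allFin-suc Os′)))
    ; viable   = λ { zero → viable₀  ; (suc i) → viable Δ i }
    ; Os-small = λ { zero → O₀-small ; (suc i) → Os-small Δ i }
    ; Bs-small = λ { zero → B₀-small ; (suc i) → Bs-small Δ i }
    ; total    = subst (_≤ ∣ O₀ ∪ B₀ ∣ + cost)
                   (cong sum (sym (map-allFin-suc (λ i → ∣ Os′ i ∪ Bs′ i ∣))))
                   (+-monoʳ-≤ ∣ O₀ ∪ B₀ ∣ (total Δ))
    }
    where
    Os′ Bs′ : Fin (suc m) → Subset n
    Os′ = O₀ Vector.∷ Os Δ
    Bs′ = B₀ Vector.∷ Bs Δ

  decomposition-resp : ∀ {m S S′ cost cost′} → S ≡ S′ → cost ≤ cost′ →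
                       Decomposition m S cost → Decomposition m S′ cost′
  decomposition-resp refl cost≤ Δ = record
    { Os = Os Δ ; Bs = Bs Δ ; covers = covers Δ ; viable = viable Δ
    ; Os-small = Os-small Δ ; Bs-small = Bs-small Δ ; total = ≤-trans (total Δ) cost≤ }

-- The forest of a viable set

sink? : ∀ {n} (D : Digraph n) u → Dec (Sink D u)
sink? D u = all? (λ v → ¬? (T? (D u v)))

record Successor {n} (D : Digraph n) (O : Subset n) : Set where
  field
    next      : Fin n → Fin n
    next-∈    : ∀ {v} → v ∈ O → next v ∈ O
    next-edge : ∀ {v} → v ∈ O → ¬ Sink D v → Edge D v (next v)
    next-sink : ∀ {v} → Sink D v → next v ≡ v

viable⇒successor : ∀ {n} (D : Digraph n) {O : Subset n} → Viable D O → Successor D O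
viable⇒successor {n} D {O} viable = record
  { next = next ; next-∈ = next-∈ ; next-edge = next-edge ; next-sink = next-sink }
  where
  classify : ∀ v → (∃[ w ] Edge D v w × w ∈ O) ⊎ (Sink D v ⊎ v ∉ O)
  classify v with v ∈? O
  ... | no  v∉O = inj₂ (inj₂ v∉O)
  ... | yes v∈O = Sum.[ inj₂ ∘ inj₁ , inj₁ ] (viable v v∈O)

  next : Fin n → Fin n
  next v = Sum.[ proj₁ , (λ _ → v) ] (classify v)

  next-∈ : ∀ {v} → v ∈ O → next v ∈ O
  next-∈ {v} v∈O with classify v
  ... | inj₁ (_ , _ , w∈O) = w∈O
  ... | inj₂ _             = v∈O

  next-edge : ∀ {v} → v ∈ O → ¬ Sink D v → Edge D v (next v)
  next-edge {v} v∈O ¬sink with classify v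
  ... | inj₁ (_ , e , _) = e
  ... | inj₂ (inj₁ sink) = contradiction sink ¬sink
  ... | inj₂ (inj₂ v∉O)  = contradiction v∈O v∉O

  next-sink : ∀ {v} → Sink D v → next v ≡ v
  next-sink {v} sink with classify v
  ... | inj₁ (w , e , _) = contradiction e (sink w)
  ... | inj₂ _           = refl

module Forest {n} {D : Digraph n} {O : Subset n} (acyclic : Acyclic D) (successor : Successor D O) where

  open Successor successor
  open import Data.List.Membership.DecPropositional (_≟_ {n}) using () renaming (_∈?_ to _∈ₗ?_)

  infix 4 _⇝_

  _⇝_ : Fin n → Fin n → Set
  u ⇝ z = ∃[ t ] iterate next u t ≡ z

  ⇝-refl : ∀ {u} → u ⇝ u
  ⇝-refl = 0 , refl

  ⇝-next : ∀ {u z} → u ⇝ z → u ⇝ next z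
  ⇝-next {u} (t , refl) = t + 1 , iterate-+ next u t 1

  next-⇝ : ∀ {u z} → next u ⇝ z → u ⇝ z
  next-⇝ (t , eq) = suc t , eq

  ⇝-trans : ∀ {u v z} → u ⇝ v → v ⇝ z → u ⇝ z
  ⇝-trans {u} (s , refl) (t , refl) = s + t , iterate-+ next u s t

  ⇝-split : ∀ {u z} → u ⇝ z → z ≡ u ⊎ next u ⇝ z
  ⇝-split (zero  , eq) = inj₁ (sym eq)
  ⇝-split (suc t , eq) = inj₂ (t , eq)

  ⇝-∈ : ∀ {u z} → u ∈ O → u ⇝ z → z ∈ O
  ⇝-∈ u∈O (zero  , refl) = u∈O
  ⇝-∈ u∈O (suc t , eq)   = ⇝-∈ (next-∈ u∈O) (t , eq)

  iterate-sink : ∀ {u} → Sink D u → ∀ t → iterate next u t ≡ u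
  iterate-sink sink zero                            = refl
  iterate-sink sink (suc t) rewrite next-sink sink = iterate-sink sink t

  sink-⇝ : ∀ {u z} → Sink D u → u ⇝ z → z ≡ u
  sink-⇝ sink (t , refl) = iterate-sink sink t

  edges-to-iterate : ∀ {u} e → u ∈ O → (∀ t → t ≤ e → ¬ Sink D (iterate next u t)) →
                     TransClosure (Edge D) u (iterate next u (suc e))
  edges-to-iterate zero    u∈O ¬sink = [ next-edge u∈O (¬sink 0 z≤n) ]
  edges-to-iterate (suc e) u∈O ¬sink = next-edge u∈O (¬sink 0 z≤n) ∷
    edges-to-iterate e (next-∈ u∈O) (λ t t≤e → ¬sink (suc t) (s≤s t≤e))

  -- Pigeonhole on the first n + 1 iterates: if none of them is a sink, two of them coincide
  -- and the edges between them form a cycle.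
  sink-within : ∀ {u} → u ∈ O → ∃[ t ] t < n × Sink D (iterate next u t)
  sink-within {u} u∈O with any? (λ (t : Fin n) → sink? D (iterate next u (toℕ t)))
  ... | yes (t , sink) = toℕ t , toℕ<n t , sink
  ... | no  no-sink    with pigeonhole ≤-refl (λ (i : Fin (suc n)) → iterate next u (toℕ i))
  ...   | i , j , i<j , same with m≤n⇒∃[o]m+o≡n i<j
  ...     | e , i+1+e≡j = contradiction cycle (acyclic w)
    where
    w = iterate next u (toℕ i)
    ¬sink : ∀ t → t ≤ e → ¬ Sink D (iterate next w t)
    ¬sink t t≤e sink =
      no-sink (fromℕ< i+t<n , subst (Sink D ∘ iterate next u) (sym (toℕ-fromℕ< i+t<n)) sink′)
      where
      i+t<n : toℕ i + t < n
      i+t<n = ≤-trans (s≤s (+-monoʳ-≤ (toℕ i) t≤e)) (subst (_≤ n) (sym i+1+e≡j) (≤-pred (toℕ<n j)))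
      sink′ : Sink D (iterate next u (toℕ i + t))
      sink′ = subst (Sink D) (sym (iterate-+ next u (toℕ i) t)) sink
    returns : iterate next w (suc e) ≡ w
    returns = begin
      iterate next w (suc e)          ≡⟨ iterate-+ next u (toℕ i) (suc e) ⟨
      iterate next u (toℕ i + suc e)  ≡⟨ cong (iterate next u) (trans (+-suc (toℕ i) e) i+1+e≡j) ⟩
      iterate next u (toℕ j)          ≡⟨ same ⟨
      w                               ∎
      where open ≡-Reasoning
    cycle : TransClosure (Edge D) w w
    cycle = subst (TransClosure (Edge D) w) returns (edges-to-iterate e (⇝-∈ u∈O (toℕ i , refl)) ¬sink)

  walk walk⁺ : ℕ → Fin n → List (Fin n)
  walk f u = u ∷ walk⁺ f u
  walk⁺ zero    u = []
  walk⁺ (suc f) u with sink? D u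
  ... | yes _ = []
  ... | no  _ = walk f (next u)

  ∈-walk⇒⇝ : ∀ f u {z} → z ∈ₗ walk f u → u ⇝ z
  ∈-walk⇒⇝ f       u (here refl) = ⇝-refl
  ∈-walk⇒⇝ (suc f) u (there z∈) with sink? D u
  ∈-walk⇒⇝ (suc f) u (there ())  | yes _
  ∈-walk⇒⇝ (suc f) u (there z∈) | no  _ = next-⇝ (∈-walk⇒⇝ f (next u) z∈)

  walk⁺-sink : ∀ f {u} → Sink D u → walk⁺ f u ≡ []
  walk⁺-sink zero        sink = refl
  walk⁺-sink (suc f) {u} sink with sink? D u
  ... | yes _    = refl
  ... | no ¬sink = contradiction sink ¬sink

  edges-to-walk⁺ : ∀ f {u z} → u ∈ O → z ∈ₗ walk⁺ f u → TransClosure (Edge D) u z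
  edges-to-walk⁺ (suc f) {u} u∈O z∈ with sink? D u
  edges-to-walk⁺ (suc f) u∈O ()          | yes _
  edges-to-walk⁺ (suc f) u∈O (here refl) | no ¬sink = [ next-edge u∈O ¬sink ]
  edges-to-walk⁺ (suc f) u∈O (there z∈)  | no ¬sink =
    next-edge u∈O ¬sink ∷ edges-to-walk⁺ f (next-∈ u∈O) z∈

  walk-sinkPath : ∀ f {u t₀} → u ∈ O → t₀ ≤ f → Sink D (iterate next u t₀) → SinkPath D (walk f u)
  walk-sinkPath zero    {t₀ = zero} u∈O z≤n sink = sink
  walk-sinkPath (suc f) {u} {t₀}    u∈O t₀≤ sink with sink? D u | t₀ | t₀≤
  ... | yes sink-u | _      | _       = sink-u
  ... | no ¬sink   | zero   | _       = contradiction sink ¬sink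
  ... | no ¬sink   | suc t₀ | s≤s t₀≤ = next-edge u∈O ¬sink , walk-sinkPath f (next-∈ u∈O) t₀≤ sink

  ⇝⇒∈-walk : ∀ f {u t₀ z} → t₀ ≤ f → Sink D (iterate next u t₀) → u ⇝ z → z ∈ₗ walk f u
  ⇝⇒∈-walk f               _   _    (zero , refl) = here refl
  ⇝⇒∈-walk zero {t₀ = zero} z≤n sink u⇝z          = here (sink-⇝ sink u⇝z)
  ⇝⇒∈-walk (suc f) {u} {t₀} t₀≤ sink (suc t , eq) with sink? D u | t₀ | t₀≤
  ... | yes sink-u | _      | _       = here (sink-⇝ sink-u (suc t , eq))
  ... | no ¬sink   | zero   | _       = contradiction sink ¬sink
  ... | no ¬sink   | suc t₀ | s≤s t₀≤ = there (⇝⇒∈-walk f t₀≤ sink (t , eq))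

  walk-n-sinkPath : ∀ {u} → u ∈ O → SinkPath D (walk n u)
  walk-n-sinkPath u∈O with sink-within u∈O
  ... | t , t<n , sink = walk-sinkPath n u∈O (<⇒≤ t<n) sink

  ⇝⇒∈-walk-n : ∀ {u z} → u ∈ O → u ⇝ z → z ∈ₗ walk n u
  ⇝⇒∈-walk-n u∈O u⇝z with sink-within u∈O
  ... | t , t<n , sink = ⇝⇒∈-walk n (<⇒≤ t<n) sink u⇝z

  next-closed⇒viable : ∀ {S} → (∀ {x} → x ∈ S → x ∈ O) → (∀ {x} → x ∈ S → next x ∈ S) → Viable D S
  next-closed⇒viable S⊆O closed x x∈S with sink? D x
  ... | yes sink = inj₁ sink
  ... | no ¬sink = inj₂ (next x , next-edge (S⊆O x∈S) ¬sink , closed x∈S)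

  -- Listings in depth-first preorder

  -- Chained (just x) (y ∷ ys): y is a root, or its parent lies on the path from x to its root;
  -- Chained nothing requires the first vertex to be a root.
  _◁_ : Maybe (Fin n) → Fin n → Set
  nothing ◁ y = Sink D y
  just x  ◁ y = Sink D y ⊎ x ⇝ next y

  Chained : Maybe (Fin n) → List (Fin n) → Set
  Chained x []       = ⊤
  Chained x (y ∷ ys) = x ◁ y × Chained (just y) ys

  Chained-weaken : ∀ {x x′} → (∀ {z} → x ◁ z → x′ ◁ z) → ∀ {ys} → Chained x ys → Chained x′ ys
  Chained-weaken x◁⇒x′◁ {[]}     _          = tt
  Chained-weaken x◁⇒x′◁ {y ∷ ys} (x◁y , ch) = x◁⇒x′◁ x◁y , ch

  Chained-take : ∀ k {x ys} → Chained x ys → Chained x (take k ys)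
  Chained-take zero                  _          = tt
  Chained-take (suc k) {ys = []}     _          = tt
  Chained-take (suc k) {ys = y ∷ ys} (x◁y , ch) = x◁y , Chained-take k ch

  Chained-drop : ∀ k {x ys} → Chained x ys → ∃[ x′ ] Chained x′ (drop k ys)
  Chained-drop zero    {x}           ch       = x , ch
  Chained-drop (suc k) {ys = []}     _        = nothing , tt
  Chained-drop (suc k) {ys = y ∷ ys} (_ , ch) = Chained-drop k ch

  ◁-closed : ∀ {y x z} → just y ◁ x → x ⇝ z → z ≡ x ⊎ y ⇝ z
  ◁-closed (inj₁ sink)   x⇝z = inj₁ (sink-⇝ sink x⇝z)
  ◁-closed (inj₂ y⇝next) x⇝z with ⇝-split x⇝z
  ... | inj₁ z≡x    = inj₁ z≡x
  ... | inj₂ next⇝z = inj₂ (⇝-trans y⇝next next⇝z)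

  Chained-closed : ∀ {y ys x z} → Chained (just y) ys → x ∈ₗ ys → x ⇝ z → z ∈ₗ ys ⊎ y ⇝ z
  Chained-closed (y◁x , _)   (here refl)  x⇝z = Sum.map₁ here (◁-closed y◁x x⇝z)
  Chained-closed (y◁x₁ , ch) (there x∈xs) x⇝z with Chained-closed ch x∈xs x⇝z
  ... | inj₁ z∈xs = inj₁ (there z∈xs)
  ... | inj₂ x₁⇝z = Sum.map₁ here (◁-closed y◁x₁ x₁⇝z)

  insertAfter-chained : ∀ {a y} → next y ≡ a → ∀ {x xs} → Chained x xs → Chained x (insertAfter a y xs)
  insertAfter-chained              next≡a {xs = []}      _           = tt
  insertAfter-chained {a} {y} next≡a {xs = x′ ∷ xs} (x◁x′ , ch) with x′ ≟ a
  ... | yes refl = x◁x′ , inj₂ (0 , sym next≡a) , Chained-weaken below ch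
    where
    below : ∀ {z} → just a ◁ z → just y ◁ z
    below (inj₁ sink) = inj₁ sink
    below (inj₂ a⇝)   = inj₂ (next-⇝ (subst (_⇝ _) (sym next≡a) a⇝))
  ... | no  _    = x◁x′ , insertAfter-chained next≡a ch

  record Listing : Set where
    field
      list    : List (Fin n)
      chained : Chained nothing list
      unique  : Unique list
      ⊆O      : All (_∈ O) list

  open Listing

  attach : ∀ v ℓ → Sink D v ⊎ next v ∈ₗ ℓ → List (Fin n)
  attach v ℓ (inj₁ _) = v ∷ ℓ
  attach v ℓ (inj₂ _) = insertAfter (next v) v ℓ

  attach-↭ : ∀ {v ℓ} h → attach v ℓ h ↭ v ∷ ℓ
  attach-↭ (inj₁ _)      = ↭.refl
  attach-↭ (inj₂ next∈ℓ) = insertAfter-↭ next∈ℓ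

  attach-chained : ∀ {v ℓ} h → Chained nothing ℓ → Chained nothing (attach v ℓ h)
  attach-chained (inj₁ sink) ch = sink , Chained-weaken inj₁ ch
  attach-chained (inj₂ _)    ch = insertAfter-chained refl ch

  Addable : Fin n → Listing → Set
  Addable v A = v ∈ O × ¬ v ∈ₗ list A × (Sink D v ⊎ next v ∈ₗ list A)

  addable? : ∀ v A → Dec (Addable v A)
  addable? v A = v ∈? O ×-dec ¬? (v ∈ₗ? list A) ×-dec (sink? D v ⊎-dec next v ∈ₗ? list A)

  extend : Fin n → Listing → Listing
  extend v A with addable? v A
  ... | no  _               = A
  ... | yes (v∈O , v∉A , h) = record
    { list    = attach v (list A) h
    ; chained = attach-chained h (chained A)
    ; unique  = Unique-resp-↭ (↭⇒↭ₛ (↭-sym (attach-↭ h))) (¬Any⇒All¬ (list A) v∉A ∷ unique A)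
    ; ⊆O      = All-resp-↭ (↭-sym (attach-↭ h)) (v∈O ∷ ⊆O A)
    }
    where open PermutationSetoid (setoid (Fin n)) using (Unique-resp-↭)

  extend-⊇ : ∀ v A {z} → z ∈ₗ list A → z ∈ₗ list (extend v A)
  extend-⊇ v A z∈A with addable? v A
  ... | no  _           = z∈A
  ... | yes (_ , _ , h) = ∈-resp-↭ (↭-sym (attach-↭ h)) (there z∈A)

  extend-∋ : ∀ v A → v ∈ O → Sink D v ⊎ next v ∈ₗ list A → v ∈ₗ list (extend v A)
  extend-∋ v A v∈O h′ with addable? v A
  ... | yes (_ , _ , h) = ∈-resp-↭ (↭-sym (attach-↭ h)) (here refl)
  ... | no  ¬addable    with v ∈ₗ? list A
  ...   | yes v∈A = v∈A
  ...   | no  v∉A = contradiction (v∈O , v∉A , h′) ¬addable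

  extendAll : List (Fin n) → Listing → Listing
  extendAll []       A = A
  extendAll (v ∷ vs) A = extendAll vs (extend v A)

  extendAll-⊇ : ∀ vs A {z} → z ∈ₗ list A → z ∈ₗ list (extendAll vs A)
  extendAll-⊇ []       A z∈A = z∈A
  extendAll-⊇ (v ∷ vs) A z∈A = extendAll-⊇ vs (extend v A) (extend-⊇ v A z∈A)

  extendAll-∋ : ∀ {v} vs A → v ∈ₗ vs → v ∈ O → Sink D v ⊎ next v ∈ₗ list A →
                v ∈ₗ list (extendAll vs A)
  extendAll-∋ (v ∷ vs) A (here refl)  v∈O h = extendAll-⊇ vs (extend v A) (extend-∋ v A v∈O h)
  extendAll-∋ (w ∷ vs) A (there v∈vs) v∈O h =
    extendAll-∋ vs (extend w A) v∈vs v∈O (Sum.map₂ (extend-⊇ w A) h)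

  rounds : ℕ → Listing
  rounds zero    = record { list = [] ; chained = tt ; unique = [] ; ⊆O = [] }
  rounds (suc j) = extendAll (allFin n) (rounds j)

  rounds-∋ : ∀ {v} t {j} → v ∈ O → Sink D (iterate next v t) → t < j → v ∈ₗ list (rounds j)
  rounds-∋ zero    {suc j} v∈O sink _         =
    extendAll-∋ (allFin n) (rounds j) (∈-allFin _) v∈O (inj₁ sink)
  rounds-∋ (suc t) {suc j} v∈O sink (s≤s t<j) =
    extendAll-∋ (allFin n) (rounds j) (∈-allFin _) v∈O (inj₂ (rounds-∋ t (next-∈ v∈O) sink t<j))

  listing : Listing
  listing = rounds n

  listing-covers : O ≡ fromList (list listing)
  listing-covers =
    ⊆-antisym (∈-fromList⁺ ∘ ∈-listing) (All.lookup (⊆O listing) ∘ ∈-fromList⁻ (list listing))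
    where
    ∈-listing : ∀ {v} → v ∈ O → v ∈ₗ list listing
    ∈-listing v∈O with sink-within v∈O
    ... | t , t<n , sink = rounds-∋ t v∈O sink t<n

  boundary : List (Fin n) → List (Fin n)
  boundary []      = []
  boundary (s ∷ _) = walk⁺ n s

  boundary-sink : ∀ {c} → Chained nothing c → boundary c ≡ []
  boundary-sink {[]}    _          = refl
  boundary-sink {_ ∷ _} (sink , _) = walk⁺-sink n sink

  chunk-closed : ∀ {x s cs z w} → Chained x (s ∷ cs) → z ∈ₗ s ∷ cs → z ⇝ w → w ∈ₗ s ∷ cs ⊎ s ⇝ w
  chunk-closed _        (here refl) z⇝w = inj₂ z⇝w
  chunk-closed (_ , ch) (there z∈)  z⇝w = Sum.map₁ there (Chained-closed ch z∈ z⇝w)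

  chunk-viable : ∀ {x c} → Chained x c → All (_∈ O) c → Viable D (fromList c ∪ fromList (boundary c))
  chunk-viable {c = []}     _  _   z z∈ = ⊥-elim (Sum.[ ∉⊥ , ∉⊥ ] (x∈p∪q⁻ ∅ ∅ z∈))
  chunk-viable {c = s ∷ cs} ch c⊆O = next-closed⇒viable S⊆O closed
    where
    S = fromList (s ∷ cs) ∪ fromList (walk⁺ n s)
    s∈O = All.head c⊆O
    ∈S⁻ : ∀ {z} → z ∈ S → z ∈ₗ s ∷ cs ⊎ s ⇝ z
    ∈S⁻ z∈ = Sum.map (∈-fromList⁻ (s ∷ cs)) (λ z∈⁺ → ∈-walk⇒⇝ n s (there (∈-fromList⁻ (walk⁺ n s) z∈⁺)))
                     (x∈p∪q⁻ (fromList (s ∷ cs)) (fromList (walk⁺ n s)) z∈)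
    ∈S⁺ : ∀ {z} → z ∈ₗ s ∷ cs ⊎ s ⇝ z → z ∈ S
    ∈S⁺ (inj₁ z∈c) = x∈p∪q⁺ (inj₁ (∈-fromList⁺ z∈c))
    ∈S⁺ (inj₂ s⇝z) with ⇝⇒∈-walk-n s∈O s⇝z
    ... | here refl = x∈p∪q⁺ (inj₁ (∈-fromList⁺ {xs = s ∷ cs} (here refl)))
    ... | there z∈⁺ = x∈p∪q⁺ (inj₂ (∈-fromList⁺ z∈⁺))
    S⊆O : ∀ {z} → z ∈ S → z ∈ O
    S⊆O z∈ = Sum.[ All.lookup c⊆O , ⇝-∈ s∈O ] (∈S⁻ z∈)
    closed : ∀ {z} → z ∈ S → next z ∈ S
    closed z∈ = ∈S⁺ (Sum.[ (λ z∈c → chunk-closed ch z∈c (1 , refl)) , inj₂ ∘ ⇝-next ] (∈S⁻ z∈))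

  module _ {L k} (Lmax : ∀ ps → SinkPath D ps → length ps ≤ L) (O≤k : ∣ O ∣ ≤ k) where

    d∸1 : ℕ
    d∸1 = (L ⊓ k) ∸ 1

    boundary-small : ∀ {c} → All (_∈ O) c → ∣ fromList (boundary c) ∣ ≤ d∸1
    boundary-small []                = subst (_≤ d∸1) (sym (∣⊥∣≡0 n)) z≤n
    boundary-small {s ∷ _} (s∈O ∷ _) = subst (_ ≤_) (sym (∸-distribʳ-⊓ 1 L k)) (⊓-glb ≤L∸1 ≤k∸1)
      where
      ≤L∸1 : ∣ fromList (walk⁺ n s) ∣ ≤ L ∸ 1
      ≤L∸1 = ≤-trans (∣fromList∣≤length (walk⁺ n s)) (∸-monoˡ-≤ 1 (Lmax _ (walk-n-sinkPath s∈O)))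
      ⊂O : fromList (walk⁺ n s) ⊂ O
      ⊂O = (λ z∈ → ⇝-∈ s∈O (∈-walk⇒⇝ n s (there (∈-fromList⁻ _ z∈)))) , s , s∈O ,
           (λ s∈ → acyclic s (edges-to-walk⁺ n s∈O (∈-fromList⁻ _ s∈)))
      ≤k∸1 : ∣ fromList (walk⁺ n s) ∣ ≤ k ∸ 1
      ≤k∸1 = ∸-monoˡ-≤ 1 (≤-trans (p⊂q⇒∣p∣<∣q∣ ⊂O) O≤k)

    L⊓k≡0⇒length≡0 : 1 ≤ k → L ⊓ k ≡ 0 → ∀ {ℓ} → All (_∈ O) ℓ → length ℓ ≡ 0
    L⊓k≡0⇒length≡0 _   _     []        = refl
    L⊓k≡0⇒length≡0 1≤k L⊓k≡0 (v∈O ∷ _) = contradiction (subst (1 ≤_) L⊓k≡0 1≤L⊓k) λ ()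
      where 1≤L⊓k = ⊓-glb (≤-trans (s≤s z≤n) (Lmax _ (walk-n-sinkPath v∈O))) 1≤k

    module _ (p : ℕ) where

      decompose-step : ∀ {m x ℓ β cost} → Chained x ℓ → All (_∈ O) ℓ →
                       ∣ fromList (boundary (take p ℓ)) ∣ ≤ β →
                       Decomposition D p d∸1 m (fromList (drop p ℓ)) (length (drop p ℓ) + cost) →
                       Decomposition D p d∸1 (suc m) (fromList ℓ) (length ℓ + (β + cost))
      decompose-step {ℓ = ℓ} {β} {cost} ch ℓ⊆O β-bound Δ =
        decomposition-resp D p d∸1 c∪r≡ℓ cost-≤
          (decomposition-∷ D p d∸1 (fromList c) B
            (chunk-viable (Chained-take p ch) c⊆O) c-small (boundary-small c⊆O) Δ)
        where
        c = take p ℓ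
        r = drop p ℓ
        B = fromList (boundary c)
        c⊆O = take⁺ p ℓ⊆O
        c++r≡ℓ : c ++ r ≡ ℓ
        c++r≡ℓ = take++drop≡id p ℓ
        c-small : ∣ fromList c ∣ ≤ p
        c-small = ≤-trans (∣fromList∣≤length c) (subst (_≤ p) (sym (length-take p ℓ)) (m⊓n≤m p _))
        c∪r≡ℓ : fromList c ∪ fromList r ≡ fromList ℓ
        c∪r≡ℓ = trans (sym (fromList-++ c r)) (cong fromList c++r≡ℓ)
        cost-≤ : ∣ fromList c ∪ B ∣ + (length r + cost) ≤ length ℓ + (β + cost)
        cost-≤ = begin
          ∣ fromList c ∪ B ∣ + (length r + cost)
            ≤⟨ +-monoˡ-≤ _ (≤-trans (∣p∪q∣≤∣p∣+∣q∣ (fromList c) B)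
                                    (+-mono-≤ (∣fromList∣≤length c) β-bound)) ⟩
          (length c + β) + (length r + cost)
            ≡⟨ interchange +-commutativeSemigroup (length c) β (length r) cost ⟩
          (length c + length r) + (β + cost)
            ≡⟨ cong (_+ (β + cost)) (trans (sym (length-++ c)) (cong length c++r≡ℓ)) ⟩
          length ℓ + (β + cost)
            ∎
          where open ≤-Reasoning

      decompose : ∀ m {x ℓ} → Chained x ℓ → All (_∈ O) ℓ → length ℓ ≤ m * p →
                  Decomposition D p d∸1 m (fromList ℓ) (length ℓ + m * d∸1)
      decompose zero    {ℓ = []} _  _   _   = decomposition-∅ D p d∸1
      decompose (suc m) {ℓ = ℓ}  ch ℓ⊆O len =
        decompose-step ch ℓ⊆O (boundary-small (take⁺ p ℓ⊆O))
          (decompose m (proj₂ (Chained-drop p ch)) (drop⁺ p ℓ⊆O) (length-drop≤ p m ℓ len))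

      -- A listing starts at a root, so its first chunk needs no boundary.
      decompose-listing : ∀ m {ℓ} → Chained nothing ℓ → All (_∈ O) ℓ → length ℓ ≤ m * p →
                          Decomposition D p d∸1 m (fromList ℓ) (length ℓ + (m ∸ 1) * d∸1)
      decompose-listing zero          = decompose zero
      decompose-listing (suc m) {ℓ} ch ℓ⊆O len =
        decompose-step ch ℓ⊆O no-boundary
          (decompose m (proj₂ (Chained-drop p ch)) (drop⁺ p ℓ⊆O) (length-drop≤ p m ℓ len))
        where
        no-boundary : ∣ fromList (boundary (take p ℓ)) ∣ ≤ 0
        no-boundary =
          ≤-reflexive (trans (cong (∣_∣ ∘ fromList) (boundary-sink (Chained-take p ch))) (∣⊥∣≡0 n))

-- Arithmetic of the final bound

k≤⌈k/p⌉*p : ∀ k q → k ≤ ⌈ k / suc q ⌉ * suc q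
k≤⌈k/p⌉*p k q = +-cancelʳ-≤ q k (⌈ k / suc q ⌉ * suc q) (begin
  k + q                                    ≡⟨ m≡m%n+[m/n]*n (k + q) (suc q) ⟩
  (k + q) % suc q + ⌈ k / suc q ⌉ * suc q  ≤⟨ +-monoˡ-≤ _ (≤-pred (m%n<n (k + q) (suc q))) ⟩
  q + ⌈ k / suc q ⌉ * suc q                ≡⟨ +-comm q _ ⟩
  ⌈ k / suc q ⌉ * suc q + q                ∎)
  where open ≤-Reasoning

p*[⌈k/p⌉∸1]≤k : ∀ k q → suc q * (⌈ k / suc q ⌉ ∸ 1) ≤ k
p*[⌈k/p⌉∸1]≤k k q = begin
  suc q * (⌈ k / suc q ⌉ ∸ 1)        ≡⟨ *-comm (suc q) _ ⟩
  (⌈ k / suc q ⌉ ∸ 1) * suc q        ≡⟨ *-distribʳ-∸ (suc q) ⌈ k / suc q ⌉ 1 ⟩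
  ⌈ k / suc q ⌉ * suc q ∸ 1 * suc q  ≡⟨ cong (⌈ k / suc q ⌉ * suc q ∸_) (*-identityˡ (suc q)) ⟩
  ⌈ k / suc q ⌉ * suc q ∸ suc q      ≤⟨ ∸-monoˡ-≤ (suc q) (m/n*n≤m (k + q) (suc q)) ⟩
  k + q ∸ suc q                      ≤⟨ ∸-monoʳ-≤ (k + q) (n≤1+n q) ⟩
  k + q ∸ q                          ≡⟨ m+n∸n≡m k q ⟩
  k                                  ∎
  where open ≤-Reasoning

p*[l+[M∸1]*[e∸1]]≤k*[p+e∸1] : ∀ {p k M e l} → l ≤ k → p * (M ∸ 1) ≤ k → (e ≡ 0 → l ≡ 0) →
                               p * (l + (M ∸ 1) * (e ∸ 1)) ≤ k * (p + e ∸ 1)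
p*[l+[M∸1]*[e∸1]]≤k*[p+e∸1] {p} {M = M} {zero} _ _ e≡0⇒l≡0
  rewrite e≡0⇒l≡0 refl | *-zeroʳ (M ∸ 1) | *-zeroʳ p = z≤n
p*[l+[M∸1]*[e∸1]]≤k*[p+e∸1] {p} {k} {M} {suc e} {l} l≤k pM≤k _ = begin
  p * (l + (M ∸ 1) * e)      ≡⟨ *-distribˡ-+ p l _ ⟩
  p * l + p * ((M ∸ 1) * e)  ≡⟨ cong (p * l +_) (*-assoc p (M ∸ 1) e) ⟨
  p * l + p * (M ∸ 1) * e    ≤⟨ +-mono-≤ (*-monoʳ-≤ p l≤k) (*-monoˡ-≤ e pM≤k) ⟩
  p * k + k * e              ≡⟨ cong (_+ k * e) (*-comm p k) ⟩
  k * p + k * e              ≡⟨ *-distribˡ-+ k p e ⟨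
  k * (p + e)                ≡⟨ cong (λ x → k * (x ∸ 1)) (+-suc p e) ⟨
  k * (p + suc e ∸ 1)        ∎
  where open ≤-Reasoning

lemma1 : (n : ℕ) (D : Digraph n) (f : Subset n → ℚ) (k p L : ℕ) →
    Acyclic D → NonNegative f → Monotone f → Submodular f →
    1 ≤ p → p ≤ k → IsMaxSinkPathNodes D L →
    (O : Subset n) → Optimal D f k O →
    Σ (Fin ⌈ k / p ⌉ → Subset n) λ Os →
    Σ (Fin ⌈ k / p ⌉ → Subset n) λ Bs →
      (O ≡ ⋃ (map Os (allFin ⌈ k / p ⌉))) ×
      (∀ i → Viable D (Os i ∪ Bs i)) ×
      (∀ i → ∣ Os i ∣ ≤ p) ×
      (∀ i → ∣ Bs i ∣ ≤ (L ⊓ k) ∸ 1) ×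
      (p * sum (map (λ i → ∣ Os i ∪ Bs i ∣) (allFin ⌈ k / p ⌉)) ≤ k * (p + (L ⊓ k) ∸ 1))
lemma1 n D f k (suc q) L acyclic _ _ _ (s≤s z≤n) p≤k (Lmax , _) O ((O-viable , O≤k) , _) =
  Os Δ , Bs Δ , trans listing-covers (covers Δ) , viable Δ , Os-small Δ , Bs-small Δ ,
  ≤-trans (*-monoʳ-≤ (suc q) (total Δ))
    (p*[l+[M∸1]*[e∸1]]≤k*[p+e∸1] {M = ⌈ k / suc q ⌉} ℓ≤k (p*[⌈k/p⌉∸1]≤k k q) empty-if-L⊓k≡0)
  where
  open Forest acyclic (viable⇒successor D O-viable)
  open Listing
  open Decomposition
  ℓ≤k : length (list listing) ≤ k
  ℓ≤k = ≤-trans (Unique⇒length≤∣p∣ (unique listing) (⊆O listing)) O≤k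
  empty-if-L⊓k≡0 : L ⊓ k ≡ 0 → length (list listing) ≡ 0
  empty-if-L⊓k≡0 L⊓k≡0 = L⊓k≡0⇒length≡0 Lmax O≤k (≤-trans (s≤s z≤n) p≤k) L⊓k≡0 (⊆O listing)
  Δ = decompose-listing Lmax O≤k (suc q) ⌈ k / suc q ⌉ (chained listing) (⊆O listing)
        (≤-trans ℓ≤k (k≤⌈k/p⌉*p k q))
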